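{- Let $n\ge 1$ be an integer with prime factorization $n=\prod_{j=1}^r p_j^{s_j}$, where $p_1,\dots,p_r$ are distinct primes and $s_j\ge 1$. Let $m$ be an integer with $1\le m\le n$, written as $m=u\prod_{i=1}^r p_i^{t_i}$ with $t_i\ge 0$ and $\gcd(u,p_i)=1$ for $1\le i\le r$. Then \[ \sum_{k=1}^n \gcd(k,n)\, e^{ -k\frac{2\pi i}{n}m} \;=\; \prod_{i=1}^r\Big[(\min(t_i,s_i)+1)\,\varphi(p_i^{s_i}) + \theta_{t_i,s_i}\, p_i^{s_i-1}\Big], \] where $\varphi$ is Euler's totient function.
   Context: For integers $t,s$, $\theta_{t,s}$ denotes the Heaviside step of $t-s$: $\theta_{t,s}=1$ if $t\ge s$ and $\theta_{t,s}=0$ if $t<s$. $\min(t,s)$ is the minimum of $t$ and $s$. An empty product equals $1$. -}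

module Defs where

open import Level using (Level)
open import Data.Nat using (ℕ; zero; suc; _≤ᵇ_)
open import Data.Nat.GCD using (gcd)
open import Data.Fin using (Fin)
open import Data.List using (List; []; _∷_; length; filter; upTo; tabulate)
open import Data.Nat.ListAction using (product)
open import Data.Bool using (if_then_else_)
open import Relation.Nullary.Decidable using (does)
open import Algebra.Bundles using (CommutativeRing)
import Data.Nat as ℕ
open import Data.Sum using (_⊎_)
open import Data.Product using (_×_)
open import Relation.Nullary using (¬_)

φ : ℕ → ℕ
φ n = length (filter (λ k → gcd (suc k) n ℕ.≟ 1) (upTo n))

θ : ℕ → ℕ → ℕ
θ t s = if s ≤ᵇ t then 1 else 0

∏ : {r : ℕ} → (Fin r → ℕ) → ℕ
∏ f = product (tabulate f)

module _ {c ℓ : Level} (R : CommutativeRing c ℓ) where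
  open CommutativeRing R

  pow : Carrier → ℕ → Carrier
  pow x zero    = 1#
  pow x (suc k) = x * pow x k

  fromℕ : ℕ → Carrier
  fromℕ zero    = 0#
  fromℕ (suc k) = 1# + fromℕ k

  sum1 : ℕ → (ℕ → Carrier) → Carrier
  sum1 zero    f = 0#
  sum1 (suc n) f = sum1 n f + f (suc n)

  NoZeroDivisors : Set (c Level.⊔ ℓ)
  NoZeroDivisors = ∀ x y → (x * y) ≈ 0# → (x ≈ 0#) ⊎ (y ≈ 0#)

  PrimitiveRoot : ℕ → Carrier → Set ℓ
  PrimitiveRoot n ζ = (pow ζ n ≈ 1#) × (∀ d → 0 ℕ.< d → d ℕ.< n → ¬ (pow ζ d ≈ 1#))

module Submission where

-- Write gcd(k,n) = #{j < n : n ∣ jk} and swap the two sums. For fixed j the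
-- k with n ∣ jk are the multiples of d = n/gcd(j,n), so the inner sum is a geometric
-- sum in a gcd(j,n)-th root of unity that equals 1 iff gcd(j,n) ∣ m. Hence the
-- character sum is the natural number W(m,n) = Σ_{j<n} [gcd(j,n) ∣ m]·gcd(j,n).
-- W(m,·) is multiplicative (Chinese remainder theorem: q ↦ q·b + c permutes the
-- residues mod a when gcd(a,b) = 1), and at prime powers
--   W(m, p^(s+1)) = φ(p^(s+1)) if p ∤ m,   W(p·m, p^(s+1)) = p·W(m, p^s) + φ(p^(s+1)),
-- which yields the local factor of p by induction on the exponent of p in m.

open import Level using (Level)
open import Data.Nat.Base using (ℕ; zero; suc; _<_; s≤s; z≤n)
import Data.Nat.Base as ℕ
import Data.Nat.Properties as ℕ
open import Algebra.Bundles using (CommutativeSemiring; CommutativeRing)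
import Relation.Binary.PropositionalEquality as ≡
open import Defs

module FiniteSums {c ℓ : Level} (S : CommutativeSemiring c ℓ) where
  open CommutativeSemiring S
  open import Relation.Binary.Reasoning.Setoid setoid

  Σ : ℕ → (ℕ → Carrier) → Carrier
  Σ zero    f = 0#
  Σ (suc n) f = f 0 + Σ n (λ k → f (suc k))

  Σ-cong : ∀ n {f g : ℕ → Carrier} → (∀ k → k < n → f k ≈ g k) → Σ n f ≈ Σ n g
  Σ-cong zero    e = refl
  Σ-cong (suc n) e = +-cong (e 0 (s≤s z≤n)) (Σ-cong n (λ k k<n → e (suc k) (s≤s k<n)))

  Σ-congᵉ : ∀ n {f g : ℕ → Carrier} → (∀ k → f k ≈ g k) → Σ n f ≈ Σ n g
  Σ-congᵉ n e = Σ-cong n (λ k _ → e k)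

  Σ-zero : ∀ n (f : ℕ → Carrier) → (∀ k → k < n → f k ≈ 0#) → Σ n f ≈ 0#
  Σ-zero zero    f e = refl
  Σ-zero (suc n) f e =
    trans (+-cong (e 0 (s≤s z≤n)) (Σ-zero n _ (λ k k<n → e (suc k) (s≤s k<n)))) (+-identityˡ 0#)

  Σ-snoc : ∀ n (f : ℕ → Carrier) → Σ (suc n) f ≈ Σ n f + f n
  Σ-snoc zero    f = trans (+-identityʳ _) (sym (+-identityˡ _))
  Σ-snoc (suc n) f = begin
    f 0 + Σ (suc n) (λ k → f (suc k))          ≈⟨ +-congˡ (Σ-snoc n (λ k → f (suc k))) ⟩
    f 0 + (Σ n (λ k → f (suc k)) + f (suc n))  ≈⟨ +-assoc _ _ _ ⟨
    Σ (suc n) f + f (suc n)                    ∎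

  Σ-rotate : ∀ n (f : ℕ → Carrier) → f 0 ≈ f n → Σ n (λ k → f (suc k)) ≈ Σ n f
  Σ-rotate zero    f e = refl
  Σ-rotate (suc n) f e = begin
    Σ (suc n) (λ k → f (suc k))     ≈⟨ Σ-snoc n (λ k → f (suc k)) ⟩
    Σ n (λ k → f (suc k)) + f (suc n) ≈⟨ +-comm _ _ ⟩
    f (suc n) + Σ n (λ k → f (suc k)) ≈⟨ +-congʳ e ⟨
    Σ (suc n) f                     ∎

  Σ-distrib-+ : ∀ n (f g : ℕ → Carrier) → Σ n (λ k → f k + g k) ≈ Σ n f + Σ n g
  Σ-distrib-+ zero    f g = sym (+-identityʳ 0#)
  Σ-distrib-+ (suc n) f g = begin
    (f 0 + g 0) + Σ n (λ k → f (suc k) + g (suc k)) ≈⟨ +-congˡ (Σ-distrib-+ n _ _) ⟩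
    (f 0 + g 0) + (F + G)                           ≈⟨ +-assoc _ _ _ ⟩
    f 0 + (g 0 + (F + G))                           ≈⟨ +-congˡ (+-assoc _ _ _) ⟨
    f 0 + ((g 0 + F) + G)                           ≈⟨ +-congˡ (+-congʳ (+-comm _ _)) ⟩
    f 0 + ((F + g 0) + G)                           ≈⟨ +-congˡ (+-assoc _ _ _) ⟩
    f 0 + (F + (g 0 + G))                           ≈⟨ +-assoc _ _ _ ⟨
    (f 0 + F) + (g 0 + G)                           ∎
    where
    F = Σ n (λ k → f (suc k))
    G = Σ n (λ k → g (suc k))

  Σ-*ˡ : ∀ n (a : Carrier) (f : ℕ → Carrier) → a * Σ n f ≈ Σ n (λ k → a * f k)
  Σ-*ˡ zero    a f = zeroʳ a
  Σ-*ˡ (suc n) a f = trans (distribˡ _ _ _) (+-congˡ (Σ-*ˡ n a _))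

  Σ-*ʳ : ∀ n (a : Carrier) (f : ℕ → Carrier) → Σ n f * a ≈ Σ n (λ k → f k * a)
  Σ-*ʳ n a f = trans (*-comm _ _) (trans (Σ-*ˡ n a f) (Σ-congᵉ n (λ k → *-comm _ _)))

  Σ-split : ∀ a b (f : ℕ → Carrier) → Σ (a ℕ.+ b) f ≈ Σ a f + Σ b (λ j → f (a ℕ.+ j))
  Σ-split zero    b f = sym (+-identityˡ _)
  Σ-split (suc a) b f = trans (+-congˡ (Σ-split a b _)) (sym (+-assoc _ _ _))

  Σ-block : ∀ g d (f : ℕ → Carrier) → Σ (g ℕ.* d) f ≈ Σ g (λ q → Σ d (λ r → f (q ℕ.* d ℕ.+ r)))
  Σ-block zero    d f = refl
  Σ-block (suc g) d f = begin
    Σ (d ℕ.+ g ℕ.* d) f                          ≈⟨ Σ-split d (g ℕ.* d) f ⟩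
    Σ d f + Σ (g ℕ.* d) (λ j → f (d ℕ.+ j))      ≈⟨ +-congˡ (Σ-block g d _) ⟩
    Σ d f + Σ g (λ q → Σ d (λ r → f (d ℕ.+ (q ℕ.* d ℕ.+ r))))
      ≈⟨ +-congˡ (Σ-congᵉ g λ q → Σ-congᵉ d λ r → reflexive (≡.cong f (≡.sym (ℕ.+-assoc d (q ℕ.* d) r)))) ⟩
    Σ (suc g) (λ q → Σ d (λ r → f (q ℕ.* d ℕ.+ r)))  ∎

  Σ-swap : ∀ a b (f : ℕ → ℕ → Carrier) →
           Σ a (λ i → Σ b (λ j → f i j)) ≈ Σ b (λ j → Σ a (λ i → f i j))
  Σ-swap zero    b f = sym (Σ-zero b _ (λ _ _ → refl))
  Σ-swap (suc a) b f = begin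
    Σ b (f 0) + Σ a (λ i → Σ b (f (suc i)))            ≈⟨ +-congˡ (Σ-swap a b _) ⟩
    Σ b (f 0) + Σ b (λ j → Σ a (λ i → f (suc i) j))    ≈⟨ Σ-distrib-+ b _ _ ⟨
    Σ b (λ j → Σ (suc a) (λ i → f i j))                ∎

module Arithmetic where
  open import Data.Nat.Base
  open import Data.Nat.Properties
  open import Data.Nat.DivMod using (_%_; _/_; m≡m%n+[m/n]*n; m%n<n)
  open import Data.Nat.Divisibility
  open import Data.Nat.GCD using (gcd; gcd[m,n]∣m; gcd[m,n]∣n; gcd[m,n]≢0; gcd-greatest; c*gcd[m,n]≡gcd[cm,cn])
  open import Data.Nat.Coprimality using (Coprime; coprime-divisor)
  import Data.Nat.Coprimality as Coprime
  open import Data.Nat.Primality using (Prime; prime⇒nonTrivial; prime⇒irreducible; euclidsLemma)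
  open import Data.Nat.Tactic.RingSolver using (solve-∀)
  open import Data.Bool.Base using (if_then_else_)
  open import Data.Sum.Base using (inj₁; inj₂)
  open import Data.Product.Base using (_,_)
  open import Data.Empty using (⊥-elim)
  open import Relation.Nullary using (¬_; Dec; yes; no; does)
  open import Relation.Binary.PropositionalEquality
  open FiniteSums +-*-commutativeSemiring public

  𝟙 : {P : Set} → Dec P → ℕ
  𝟙 d = if does d then 1 else 0

  𝟙-yes : {P : Set} (d : Dec P) → P → 𝟙 d ≡ 1
  𝟙-yes (yes _) _ = refl
  𝟙-yes (no ¬p) p = ⊥-elim (¬p p)

  𝟙-no : {P : Set} (d : Dec P) → ¬ P → 𝟙 d ≡ 0
  𝟙-no (yes p) ¬p = ⊥-elim (¬p p)
  𝟙-no (no _)  _  = refl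

  𝟙-cong : {P Q : Set} → (P → Q) → (Q → P) → (d : Dec P) (e : Dec Q) → 𝟙 d ≡ 𝟙 e
  𝟙-cong P⇒Q Q⇒P (yes p) e = sym (𝟙-yes e (P⇒Q p))
  𝟙-cong P⇒Q Q⇒P (no ¬p) e = sym (𝟙-no e (λ q → ¬p (Q⇒P q)))

  Σ-const : ∀ n c → Σ n (λ _ → c) ≡ n * c
  Σ-const zero    c = refl
  Σ-const (suc n) c = cong (c +_) (Σ-const n c)

  Σ-pick : ∀ n k (F : ℕ → ℕ) → k < n → Σ n (λ x → 𝟙 (k ≟ x) * F x) ≡ F k
  Σ-pick (suc n) zero    F _         =
    trans (cong (F 0 + 0 +_) (Σ-zero n _ (λ _ _ → refl))) (trans (+-identityʳ _) (+-identityʳ _))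
  Σ-pick (suc n) (suc k) F (s≤s k<n) = Σ-pick n k (λ x → F (suc x)) k<n

  hits : (ℕ → ℕ) → ℕ → ℕ → ℕ
  hits σ a x = Σ a (λ q → 𝟙 (σ q ≟ x))

  InjectiveBelow : (ℕ → ℕ) → ℕ → Set
  InjectiveBelow σ a = ∀ q q' → q < a → q' < a → σ q ≡ σ q' → q ≡ q'

  hits≤1 : ∀ σ a x → InjectiveBelow σ a → hits σ a x ≤ 1
  hits≤1 σ zero    x inj = z≤n
  hits≤1 σ (suc a) x inj with σ 0 ≟ x
  ... | yes σ0≡x = ≤-reflexive (cong₂ _+_ (𝟙-yes (σ 0 ≟ x) σ0≡x) (Σ-zero a _ λ q q<a →
                     𝟙-no (σ (suc q) ≟ x) λ σq≡x →
                       0≢1+n (inj 0 (suc q) z<s (s≤s q<a) (trans σ0≡x (sym σq≡x)))))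
  ... | no  σ0≢x = ≤-trans (≤-reflexive (cong (_+ hits (λ q → σ (suc q)) a x) (𝟙-no (σ 0 ≟ x) σ0≢x)))
                     (hits≤1 (λ q → σ (suc q)) a x λ q q' q<a q'<a e →
                       suc-injective (inj (suc q) (suc q') (s≤s q<a) (s≤s q'<a) e))

  -- Every q < a hits exactly one x < a, so the hit counts add up to a.
  Σ-hits : ∀ σ a → (∀ q → q < a → σ q < a) → Σ a (hits σ a) ≡ a
  Σ-hits σ a σ<a = begin
    Σ a (λ x → Σ a (λ q → 𝟙 (σ q ≟ x)))   ≡⟨ Σ-swap a a _ ⟩
    Σ a (λ q → Σ a (λ x → 𝟙 (σ q ≟ x)))   ≡⟨ Σ-cong a (λ q q<a → trans (Σ-congᵉ a (λ x → sym (*-identityʳ _)))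
                                                                     (Σ-pick a (σ q) (λ _ → 1) (σ<a q q<a))) ⟩
    Σ a (λ _ → 1)                          ≡⟨ trans (Σ-const a 1) (*-identityʳ a) ⟩
    a                                      ∎
    where open ≡-Reasoning

  Σ≤ : ∀ n (C : ℕ → ℕ) → (∀ k → k < n → C k ≤ 1) → Σ n C ≤ n
  Σ≤ zero    C h = z≤n
  Σ≤ (suc n) C h = +-mono-≤ (h 0 z<s) (Σ≤ n _ (λ k k<n → h (suc k) (s≤s k<n)))

  all-one : ∀ n (C : ℕ → ℕ) → (∀ k → k < n → C k ≤ 1) → Σ n C ≡ n → ∀ k → k < n → C k ≡ 1
  all-one (suc n) C h e zero    _         = head≡1
    where
    head≡1 : C 0 ≡ 1
    head≡1 = ≤-antisym (h 0 z<s) (+-cancelʳ-≤ n 1 (C 0)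
               (≤-trans (≤-reflexive (sym e)) (+-monoʳ-≤ (C 0) (Σ≤ n _ (λ k k<n → h (suc k) (s≤s k<n))))))
  all-one (suc n) C h e (suc k) (s≤s k<n) =
    all-one n (λ k → C (suc k)) (λ k k<n → h (suc k) (s≤s k<n))
      (suc-injective (trans (cong (_+ Σ n (λ k → C (suc k))) (sym (all-one (suc n) C h e zero z<s))) e)) k k<n

  Σ-injection : ∀ a (σ : ℕ → ℕ) → (∀ q → q < a → σ q < a) → InjectiveBelow σ a →
                (F : ℕ → ℕ) → Σ a (λ q → F (σ q)) ≡ Σ a F
  Σ-injection a σ σ<a inj F = begin
    Σ a (λ q → F (σ q))                             ≡⟨ Σ-cong a (λ q q<a → sym (Σ-pick a (σ q) F (σ<a q q<a))) ⟩
    Σ a (λ q → Σ a (λ x → 𝟙 (σ q ≟ x) * F x))       ≡⟨ Σ-swap a a _ ⟩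
    Σ a (λ x → Σ a (λ q → 𝟙 (σ q ≟ x) * F x))       ≡⟨ Σ-congᵉ a (λ x → sym (Σ-*ʳ a (F x) _)) ⟩
    Σ a (λ x → hits σ a x * F x)                    ≡⟨ Σ-cong a (λ x x<a → cong (_* F x) (hits≡1 x x<a)) ⟩
    Σ a (λ x → 1 * F x)                             ≡⟨ Σ-congᵉ a (λ x → *-identityˡ (F x)) ⟩
    Σ a F                                           ∎
    where
    open ≡-Reasoning
    hits≡1 : ∀ x → x < a → hits σ a x ≡ 1
    hits≡1 = all-one a (hits σ a) (λ x _ → hits≤1 σ a x inj) (Σ-hits σ a σ<a)

  %-eq⇒∣ : ∀ X Z a .{{_ : NonZero a}} → X % a ≡ (X + Z) % a → a ∣ Z
  %-eq⇒∣ X Z a e = divides ((X + Z) / a ∸ X / a) (begin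
    Z                                                  ≡⟨ m+n∸m≡n X Z ⟨
    (X + Z) ∸ X                                        ≡⟨ cong₂ _∸_ (m≡m%n+[m/n]*n (X + Z) a) (m≡m%n+[m/n]*n X a) ⟩
    ((X + Z) % a + (X + Z) / a * a) ∸ (X % a + X / a * a) ≡⟨ cong (λ v → ((X + Z) % a + (X + Z) / a * a) ∸ (v + X / a * a)) e ⟩
    ((X + Z) % a + (X + Z) / a * a) ∸ ((X + Z) % a + X / a * a) ≡⟨ [m+n]∸[m+o]≡n∸o ((X + Z) % a) _ _ ⟩
    (X + Z) / a * a ∸ X / a * a                        ≡⟨ *-distribʳ-∸ a ((X + Z) / a) (X / a) ⟨
    ((X + Z) / a ∸ X / a) * a                          ∎)
    where open ≡-Reasoning

  ∣∧<⇒≡0 : ∀ {a x} → a ∣ x → x < a → x ≡ 0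
  ∣∧<⇒≡0 {x = zero}  _ _  = refl
  ∣∧<⇒≡0 {x = suc x} d lt = ⊥-elim (<-irrefl refl (<-≤-trans lt (∣⇒≤ d)))

  -- The case q ≤ q' of injectivity: a ∣ b·(q' − q) forces q' − q = 0.
  affine-injective-≤ : ∀ a b c .{{_ : NonZero a}} → Coprime a b → ∀ {q q'} → q ≤ q' → q' < a →
                       (q * b + c) % a ≡ (q' * b + c) % a → q ≡ q'
  affine-injective-≤ a b c cop {q} {q'} q≤q' q'<a e =
    ≤-antisym q≤q' (m∸n≡0⇒m≤n (∣∧<⇒≡0 a∣q'-q (≤-<-trans (m∸n≤m q' q) q'<a)))
    where
    step : ∀ q d b c → (q * b + c) + b * d ≡ (q + d) * b + c
    step = solve-∀
    a∣q'-q : a ∣ q' ∸ q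
    a∣q'-q = coprime-divisor cop (%-eq⇒∣ (q * b + c) (b * (q' ∸ q)) a (begin
      (q * b + c) % a                ≡⟨ e ⟩
      (q' * b + c) % a               ≡⟨ cong (λ v → (v * b + c) % a) (m+[n∸m]≡n q≤q') ⟨
      ((q + (q' ∸ q)) * b + c) % a   ≡⟨ cong (_% a) (step q (q' ∸ q) b c) ⟨
      (q * b + c + b * (q' ∸ q)) % a ∎))
      where open ≡-Reasoning

  affine-injective : ∀ a b c .{{_ : NonZero a}} → Coprime a b →
                     InjectiveBelow (λ q → (q * b + c) % a) a
  affine-injective a b c cop q q' q<a q'<a e with ≤-total q q'
  ... | inj₁ q≤q' = affine-injective-≤ a b c cop q≤q' q'<a e
  ... | inj₂ q'≤q = sym (affine-injective-≤ a b c cop q'≤q q<a (sym e))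

  Σ-affine : ∀ a b c .{{_ : NonZero a}} → Coprime a b → (F : ℕ → ℕ) → (∀ y → F y ≡ F (y % a)) →
             Σ a (λ q → F (q * b + c)) ≡ Σ a F
  Σ-affine a b c cop F periodic =
    trans (Σ-congᵉ a (λ q → periodic (q * b + c)))
          (Σ-injection a (λ q → (q * b + c) % a) (λ q _ → m%n<n _ a) (affine-injective a b c cop) F)

  gcd-ext : ∀ {x y a} → (∀ {d} → d ∣ a → d ∣ x → d ∣ y) → (∀ {d} → d ∣ a → d ∣ y → d ∣ x) →
            gcd x a ≡ gcd y a
  gcd-ext {x} {y} {a} x⇒y y⇒x = ∣-antisym
    (gcd-greatest (x⇒y (gcd[m,n]∣n x a) (gcd[m,n]∣m x a)) (gcd[m,n]∣n x a))
    (gcd-greatest (y⇒x (gcd[m,n]∣n y a) (gcd[m,n]∣m y a)) (gcd[m,n]∣n y a))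

  gcd-shift : ∀ y k a → gcd (k * a + y) a ≡ gcd y a
  gcd-shift y k a = gcd-ext (λ d∣a d∣x → ∣m+n∣m⇒∣n d∣x (∣n⇒∣m*n k d∣a))
                            (λ d∣a d∣y → ∣m∣n⇒∣m+n (∣n⇒∣m*n k d∣a) d∣y)

  gcd-mod : ∀ y a .{{_ : NonZero a}} → gcd y a ≡ gcd (y % a) a
  gcd-mod y a = trans (cong (λ v → gcd v a) (trans (m≡m%n+[m/n]*n y a) (+-comm (y % a) _)))
                      (gcd-shift (y % a) (y / a) a)

  -- gcd(n, n) = n, used to identify the index n with the index 0 modulo n.
  gcd-idem : ∀ n → gcd n n ≡ n
  gcd-idem n = ∣-antisym (gcd[m,n]∣m n n) (gcd-greatest ∣-refl ∣-refl)

  coprime-∣ : ∀ {a b c d} → Coprime a b → c ∣ a → d ∣ b → Coprime c d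
  coprime-∣ cop c∣a d∣b (e∣c , e∣d) = cop (∣-trans e∣c c∣a , ∣-trans e∣d d∣b)

  coprime⇒*∣ : ∀ {x y m} → Coprime x y → x ∣ m → y ∣ m → x * y ∣ m
  coprime⇒*∣ {x} {y} {m} cop (divides q m≡qx) y∣m
    with divides r q≡ry ← coprime-divisor (Coprime.sym cop) (subst (y ∣_) (trans m≡qx (*-comm q x)) y∣m)
    = divides r (begin
      m           ≡⟨ m≡qx ⟩
      q * x       ≡⟨ cong (_* x) q≡ry ⟩
      r * y * x   ≡⟨ *-assoc r y x ⟩
      r * (y * x) ≡⟨ cong (r *_) (*-comm y x) ⟩
      r * (x * y) ∎)
    where open ≡-Reasoning

  coprime-*ʳ : ∀ {a b c} → Coprime a b → Coprime a c → Coprime a (b * c)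
  coprime-*ʳ cab cac (d∣a , d∣bc) = cac (d∣a , coprime-divisor (coprime-∣ cab d∣a ∣-refl) d∣bc)

  coprime-^ʳ : ∀ {a p} k → Coprime a p → Coprime a (p ^ k)
  coprime-^ʳ zero    cop (_ , d∣1) = ∣1⇒≡1 d∣1
  coprime-^ʳ (suc k) cop = coprime-*ʳ cop (coprime-^ʳ k cop)

  gcd-multiplicative : ∀ j a b → Coprime a b → gcd j (a * b) ≡ gcd j a * gcd j b
  gcd-multiplicative j a b cop = ∣-antisym d∣g₁g₂ g₁g₂∣d
    where
    g₁ = gcd j a
    g₂ = gcd j b
    d = gcd j (a * b)
    g₁g₂∣d : g₁ * g₂ ∣ d
    g₁g₂∣d = gcd-greatest
      (coprime⇒*∣ (coprime-∣ cop (gcd[m,n]∣n j a) (gcd[m,n]∣n j b)) (gcd[m,n]∣m j a) (gcd[m,n]∣m j b))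
      (*-pres-∣ (gcd[m,n]∣n j a) (gcd[m,n]∣n j b))
    d∣j : d ∣ j
    d∣j = gcd[m,n]∣m j (a * b)
    d∣ag₂ : d ∣ a * g₂
    d∣ag₂ = subst (d ∣_) (sym (c*gcd[m,n]≡gcd[cm,cn] a j b))
                  (gcd-greatest (∣n⇒∣m*n a d∣j) (gcd[m,n]∣n j (a * b)))
    d∣g₁g₂ : d ∣ g₁ * g₂
    d∣g₁g₂ = subst (d ∣_) (trans (sym (c*gcd[m,n]≡gcd[cm,cn] g₂ j a)) (*-comm g₂ g₁))
                   (gcd-greatest (∣n⇒∣m*n g₂ d∣j) (subst (d ∣_) (*-comm a g₂) d∣ag₂))

  prime>1 : ∀ {p} → Prime p → 1 < p
  prime>1 {p} pp = nonTrivial⇒n>1 p {{prime⇒nonTrivial pp}}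

  prime≢1 : ∀ {p} → Prime p → p ≢ 1
  prime≢1 pp p≡1 = <-irrefl (sym p≡1) (prime>1 pp)

  prime∤⇒coprime : ∀ {p x} → Prime p → ¬ p ∣ x → Coprime x p
  prime∤⇒coprime pp p∤x (d∣x , d∣p) with prime⇒irreducible pp d∣p
  ... | inj₁ d≡1 = d≡1
  ... | inj₂ d≡p = ⊥-elim (p∤x (subst (_∣ _) d≡p d∣x))

  prime∤^ : ∀ {p a} → Prime p → ¬ p ∣ a → ∀ k → ¬ p ∣ a ^ k
  prime∤^ pp p∤a zero    p∣1 = prime≢1 pp (∣1⇒≡1 p∣1)
  prime∤^ {a = a} pp p∤a (suc k) p∣aᵏ⁺¹ with euclidsLemma a (a ^ k) pp p∣aᵏ⁺¹
  ... | inj₁ p∣a  = p∤a p∣a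
  ... | inj₂ p∣aᵏ = prime∤^ pp p∤a k p∣aᵏ

  distinct-primes-∤ : ∀ {p q} → Prime p → Prime q → p ≢ q → ¬ p ∣ q
  distinct-primes-∤ pp pq p≢q p∣q with prime⇒irreducible pq p∣q
  ... | inj₁ p≡1 = prime≢1 pp p≡1
  ... | inj₂ p≡q = p≢q p≡q

  gcd-prime-power≡1 : ∀ {p} x k → Prime p → ¬ p ∣ x → gcd x (p ^ k) ≡ 1
  gcd-prime-power≡1 x k pp p∤x = Coprime.coprime⇒gcd≡1 (coprime-^ʳ k (prime∤⇒coprime pp p∤x))

  ∤-nonzero-residue : ∀ p q r → suc r < p → ¬ p ∣ q * p + suc r
  ∤-nonzero-residue p q r r+1<p p∣ = <-irrefl refl (<-≤-trans r+1<p (∣⇒≤ (∣m+n∣m⇒∣n p∣ (n∣m*n q))))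

  -- Write n = d·gcd(x, n). Then n ∣ x·y iff d ∣ y, since d is coprime to x / gcd(x, n).
  cofactor∣⇒∣* : ∀ x n d y → n ≡ d * gcd x n → d ∣ y → n ∣ x * y
  cofactor∣⇒∣* x n d y n≡dg d∣y = subst₂ _∣_ (sym n≡dg) (*-comm y x) (*-pres-∣ d∣y (gcd[m,n]∣m x n))

  ∣*⇒cofactor∣ : ∀ x n d y .{{_ : NonZero n}} → n ≡ d * gcd x n → n ∣ x * y → d ∣ y
  ∣*⇒cofactor∣ x n d y n≡dg n∣xy with divides x′ x≡x′g ← gcd[m,n]∣m x n = coprime-divisor d⊥x′ d∣x′y
    where
    g = gcd x n
    instance
      g≢0 : NonZero g
      g≢0 = ≢-nonZero (gcd[m,n]≢0 x n (inj₂ (≢-nonZero⁻¹ n)))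
    d⊥x′ : Coprime d x′
    d⊥x′ {e} (e∣d , e∣x′) = ∣1⇒≡1 (*-cancelʳ-∣ g (subst (e * g ∣_) (sym (*-identityˡ g))
      (gcd-greatest (subst (e * g ∣_) (sym x≡x′g) (*-monoˡ-∣ g e∣x′))
                    (subst (e * g ∣_) (sym n≡dg) (*-monoˡ-∣ g e∣d)))))
    regroup : ∀ a b c → a * b * c ≡ a * c * b
    regroup = solve-∀
    d∣x′y : d ∣ x′ * y
    d∣x′y = *-cancelʳ-∣ g (subst₂ _∣_ n≡dg (trans (cong (_* y) x≡x′g) (regroup x′ g y)) n∣xy)

  cofactor-nonZero : ∀ {n d g} .{{_ : NonZero n}} → n ≡ d * g → NonZero d
  cofactor-nonZero {n} {d} {g} n≡dg = ≢-nonZero (λ d≡0 → ≢-nonZero⁻¹ n (trans n≡dg (cong (_* g) d≡0)))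

  divisor-coprime-pred : ∀ {g n} .{{_ : NonZero n}} → g ∣ n → Coprime g (n ∸ 1)
  divisor-coprime-pred {g} {n} g∣n (e∣g , e∣n-1) =
    ∣1⇒≡1 (∣m+n∣m⇒∣n (subst (_ ∣_) (sym (m∸n+n≡m (>-nonZero⁻¹ n))) (∣-trans e∣g g∣n)) e∣n-1)

module WeightedGcdSum where
  open import Data.Nat.Base
  open import Data.Nat.Properties
  open import Data.Nat.Divisibility
  open import Data.Nat.GCD using (gcd; gcd[m,n]∣n; gcd-identityˡ; gcd-zeroʳ; c*gcd[m,n]≡gcd[cm,cn])
  open import Data.Nat.Coprimality using (Coprime)
  import Data.Nat.Coprimality as Coprime
  open import Data.Nat.Primality using (Prime; prime⇒nonZero; euclidsLemma)
  open import Data.Nat.Tactic.RingSolver using (solve-∀)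
  open import Data.Fin.Base using (Fin; zero; suc)
  import Data.Fin.Properties as Fin
  open import Data.List.Base using (length; filter; applyUpTo)
  open import Data.Sum.Base using (inj₁; inj₂)
  open import Data.Product.Base using (_,_)
  open import Function.Base using (_∘′_)
  open import Function.Definitions using (Injective)
  open import Relation.Nullary using (¬_; yes; no)
  open import Relation.Unary using (Pred; Decidable)
  open import Relation.Binary.PropositionalEquality
  open import Defs using (φ; θ; ∏)
  open Arithmetic

  -- Splitting j < p^(s+1) as j = q·p + r: the multiples of p (r = 0) have
  -- gcd(j, p^(s+1)) = p·gcd(q, p^s), the other p^s(p-1) residues are coprime to p.
  Σ-gcd-prime-power : ∀ {p} → Prime p → ∀ s (F : ℕ → ℕ) →
    Σ (p ^ suc s) (λ j → F (gcd j (p ^ suc s))) ≡ Σ (p ^ s) (λ q → F (p * gcd q (p ^ s))) + p ^ s * (p ∸ 1) * F 1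
  Σ-gcd-prime-power {zero} pp s F with () ← prime>1 pp
  Σ-gcd-prime-power {p@(suc p′)} pp s F = begin
    Σ (p * p ^ s) G                                                  ≡⟨ cong (λ N → Σ N G) (*-comm p (p ^ s)) ⟩
    Σ (p ^ s * p) G                                                  ≡⟨ Σ-block (p ^ s) p G ⟩
    Σ (p ^ s) (λ q → G (q * p + 0) + Σ p′ (λ r → G (q * p + suc r)))  ≡⟨ Σ-congᵉ (p ^ s) (λ q →
                                                                          cong₂ _+_ (cong F (gcd-multiple q)) (Σ-cong p′ λ r r<p′ →
                                                                            cong F (gcd-prime-power≡1 _ (suc s) pp (∤-nonzero-residue p q r (s≤s r<p′))))) ⟩
    Σ (p ^ s) (λ q → A q + Σ p′ (λ _ → F 1))                         ≡⟨ Σ-distrib-+ (p ^ s) A _ ⟩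
    Σ (p ^ s) A + Σ (p ^ s) (λ _ → Σ p′ (λ _ → F 1))                 ≡⟨ cong (Σ (p ^ s) A +_) (trans (Σ-const (p ^ s) _)
                                                                          (trans (cong (p ^ s *_) (Σ-const p′ (F 1))) (sym (*-assoc (p ^ s) p′ (F 1))))) ⟩
    Σ (p ^ s) A + p ^ s * p′ * F 1                                   ∎
    where
    open ≡-Reasoning
    G A : ℕ → ℕ
    G j = F (gcd j (p ^ suc s))
    A q = F (p * gcd q (p ^ s))
    gcd-multiple : ∀ q → gcd (q * p + 0) (p ^ suc s) ≡ p * gcd q (p ^ s)
    gcd-multiple q = trans (cong (λ v → gcd v (p ^ suc s)) (trans (+-identityʳ _) (*-comm q p)))
                           (sym (c*gcd[m,n]≡gcd[cm,cn] p q (p ^ s)))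

  length-filter : ∀ {P : Pred ℕ _} (P? : Decidable P) n (f : ℕ → ℕ) →
                  length (filter P? (applyUpTo f n)) ≡ Σ n (λ k → 𝟙 (P? (f k)))
  length-filter P? zero    f = refl
  length-filter P? (suc n) f with P? (f 0)
  ... | yes _ = cong suc (length-filter P? n (λ k → f (suc k)))
  ... | no  _ = length-filter P? n (λ k → f (suc k))

  -- φ(n) = #{ j < n : gcd(j, n) = 1 }  (the residue n ≡ 0 is traded for 0).
  φ-as-sum : ∀ n → φ n ≡ Σ n (λ j → 𝟙 (gcd j n ≟ 1))
  φ-as-sum n = trans (length-filter (λ k → gcd (suc k) n ≟ 1) n (λ k → k))
                     (Σ-rotate n (λ j → 𝟙 (gcd j n ≟ 1))
                       (cong (λ g → 𝟙 (g ≟ 1)) (trans (gcd-identityˡ n) (sym (gcd-idem n)))))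

  -- φ(p^(s+1)) = p^s·(p-1): exactly the multiples of p are not coprime to p^(s+1).
  φ-prime-power : ∀ {p} → Prime p → ∀ s → φ (p ^ suc s) ≡ p ^ s * (p ∸ 1)
  φ-prime-power {p} pp s = begin
    φ (p ^ suc s)                                                     ≡⟨ φ-as-sum (p ^ suc s) ⟩
    Σ (p ^ suc s) (λ j → 𝟙 (gcd j (p ^ suc s) ≟ 1))                   ≡⟨ Σ-gcd-prime-power pp s (λ g → 𝟙 (g ≟ 1)) ⟩
    Σ (p ^ s) (λ q → 𝟙 (p * gcd q (p ^ s) ≟ 1)) + p ^ s * (p ∸ 1) * 1 ≡⟨ cong₂ _+_ multiples-excluded (*-identityʳ _) ⟩
    p ^ s * (p ∸ 1)                                                   ∎
    where
    open ≡-Reasoning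
    multiples-excluded : Σ (p ^ s) (λ q → 𝟙 (p * gcd q (p ^ s) ≟ 1)) ≡ 0
    multiples-excluded = Σ-zero (p ^ s) _ λ q _ → 𝟙-no (_ ≟ 1) (prime≢1 pp ∘′ m*n≡1⇒m≡1 p _)

  weight : ℕ → ℕ → ℕ
  weight m g = g * 𝟙 (g ∣? m)

  -- W(m, n) = Σ_{j<n} weight m (gcd(j, n)); the character sum turns out to be W(m, n).
  W : ℕ → ℕ → ℕ
  W m n = Σ n (λ j → weight m (gcd j n))

  𝟙-∣-multiplicative : ∀ m x y → Coprime x y → 𝟙 (x * y ∣? m) ≡ 𝟙 (x ∣? m) * 𝟙 (y ∣? m)
  𝟙-∣-multiplicative m x y cop with x ∣? m | y ∣? m
  ... | yes x∣m | yes y∣m = 𝟙-yes (x * y ∣? m) (coprime⇒*∣ cop x∣m y∣m)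
  ... | yes _   | no  y∤m = 𝟙-no (x * y ∣? m) (y∤m ∘′ m*n∣⇒n∣ x y)
  ... | no  x∤m | _       = 𝟙-no (x * y ∣? m) (x∤m ∘′ m*n∣⇒m∣ x y)

  weight-multiplicative : ∀ m x y → Coprime x y → weight m (x * y) ≡ weight m x * weight m y
  weight-multiplicative m x y cop = begin
    x * y * 𝟙 (x * y ∣? m)             ≡⟨ cong (x * y *_) (𝟙-∣-multiplicative m x y cop) ⟩
    x * y * (𝟙 (x ∣? m) * 𝟙 (y ∣? m))  ≡⟨ interchange x y (𝟙 (x ∣? m)) (𝟙 (y ∣? m)) ⟩
    x * 𝟙 (x ∣? m) * (y * 𝟙 (y ∣? m))  ∎
    where
    open ≡-Reasoning
    interchange : ∀ a b c d → a * b * (c * d) ≡ a * c * (b * d)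
    interchange = solve-∀

  weight-one : ∀ m → weight m 1 ≡ 1
  weight-one m = cong (1 *_) (𝟙-yes (1 ∣? m) (1∣ m))

  weight-∤ : ∀ {p} m g → ¬ p ∣ m → weight m (p * g) ≡ 0
  weight-∤ {p} m g p∤m = trans (cong (p * g *_) (𝟙-no (p * g ∣? m) (p∤m ∘′ m*n∣⇒m∣ p g))) (*-zeroʳ (p * g))

  weight-scale : ∀ p .{{_ : NonZero p}} m g → weight (p * m) (p * g) ≡ p * weight m g
  weight-scale p m g = trans (cong (p * g *_) (𝟙-cong (*-cancelˡ-∣ p) (*-monoʳ-∣ p) (p * g ∣? p * m) (g ∣? m)))
                             (*-assoc p g _)

  -- Multiplicativity in n. Writing j = q·b + r (q < a, r < b): gcd(j, b) depends
  -- only on r, and for fixed r the numbers q·b + r run over all residues mod a.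
  W-multiplicative : ∀ m a b .{{_ : NonZero a}} → Coprime a b → W m (a * b) ≡ W m a * W m b
  W-multiplicative m a b cop = begin
    Σ (a * b) (λ j → weight m (gcd j (a * b)))    ≡⟨ Σ-congᵉ (a * b) split-weight ⟩
    Σ (a * b) (λ j → F j * G j)                   ≡⟨ Σ-block a b _ ⟩
    Σ a (λ q → Σ b (λ r → F (q * b + r) * G (q * b + r)))
      ≡⟨ Σ-congᵉ a (λ q → Σ-congᵉ b (λ r → cong (λ g → F (q * b + r) * weight m g) (gcd-shift r q b))) ⟩
    Σ a (λ q → Σ b (λ r → F (q * b + r) * G r))   ≡⟨ Σ-swap a b _ ⟩
    Σ b (λ r → Σ a (λ q → F (q * b + r) * G r))   ≡⟨ Σ-congᵉ b (λ r → Σ-*ʳ a (G r) _) ⟨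
    Σ b (λ r → Σ a (λ q → F (q * b + r)) * G r)   ≡⟨ Σ-congᵉ b (λ r → cong (_* G r)
                                                       (Σ-affine a b r cop F (λ y → cong (weight m) (gcd-mod y a)))) ⟩
    Σ b (λ r → Σ a F * G r)                       ≡⟨ Σ-*ˡ b (Σ a F) G ⟨
    Σ a F * Σ b G                                 ∎
    where
    open ≡-Reasoning
    F G : ℕ → ℕ
    F j = weight m (gcd j a)
    G j = weight m (gcd j b)
    split-weight : ∀ j → weight m (gcd j (a * b)) ≡ F j * G j
    split-weight j = trans (cong (weight m) (gcd-multiplicative j a b cop))
                           (weight-multiplicative m _ _ (coprime-∣ cop (gcd[m,n]∣n j a) (gcd[m,n]∣n j b)))

  W-one : ∀ m → W m 1 ≡ 1
  W-one m = trans (+-identityʳ _) (trans (cong (weight m) (gcd-zeroʳ 0)) (weight-one m))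

  -- At a prime power p^(s+1) with p ∤ m only the residues coprime to p contribute.
  W-prime-power-∤ : ∀ {p} → Prime p → ∀ s m → ¬ p ∣ m → W m (p ^ suc s) ≡ p ^ s * (p ∸ 1)
  W-prime-power-∤ {p} pp s m p∤m = begin
    W m (p ^ suc s)                                                       ≡⟨ Σ-gcd-prime-power pp s (weight m) ⟩
    Σ (p ^ s) (λ q → weight m (p * gcd q (p ^ s))) + p ^ s * (p ∸ 1) * weight m 1
      ≡⟨ cong₂ _+_ (Σ-zero (p ^ s) _ λ q _ → weight-∤ m _ p∤m) (cong (p ^ s * (p ∸ 1) *_) (weight-one m)) ⟩
    p ^ s * (p ∸ 1) * 1                                                   ≡⟨ *-identityʳ _ ⟩
    p ^ s * (p ∸ 1)                                                       ∎
    where open ≡-Reasoning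

  -- A factor p of m multiplies the contribution of the multiples of p by p.
  W-prime-power-p∣ : ∀ {p} → Prime p → ∀ s m → W (p * m) (p ^ suc s) ≡ p * W m (p ^ s) + p ^ s * (p ∸ 1)
  W-prime-power-p∣ {p} pp s m = begin
    W (p * m) (p ^ suc s)                                                 ≡⟨ Σ-gcd-prime-power pp s (weight (p * m)) ⟩
    Σ (p ^ s) (λ q → weight (p * m) (p * gcd q (p ^ s))) + p ^ s * (p ∸ 1) * weight (p * m) 1
      ≡⟨ cong₂ _+_ (Σ-congᵉ (p ^ s) λ q → weight-scale p {{prime⇒nonZero pp}} m _)
                   (trans (cong (p ^ s * (p ∸ 1) *_) (weight-one (p * m))) (*-identityʳ _)) ⟩
    Σ (p ^ s) (λ q → p * weight m (gcd q (p ^ s))) + p ^ s * (p ∸ 1)       ≡⟨ cong (_+ p ^ s * (p ∸ 1)) (Σ-*ˡ (p ^ s) p _) ⟨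
    p * W m (p ^ s) + p ^ s * (p ∸ 1)                                     ∎
    where open ≡-Reasoning

  W-prime-power : ∀ {p} → Prime p → ∀ s t w → ¬ p ∣ w →
                  W (p ^ t * w) (p ^ suc s) ≡ (t ⊓ suc s + 1) * (p ^ s * (p ∸ 1)) + θ t (suc s) * p ^ s
  W-prime-power {p} pp s zero w p∤w =
    trans (W-prime-power-∤ pp s (1 * w) (p∤w ∘′ subst (p ∣_) (*-identityˡ w)))
          (sym (trans (+-identityʳ _) (+-identityʳ _)))
  W-prime-power {p} pp s (suc t) w p∤w = begin
    W (p ^ suc t * w) (p ^ suc s)                ≡⟨ cong (λ m → W m (p ^ suc s)) (*-assoc p (p ^ t) w) ⟩
    W (p * (p ^ t * w)) (p ^ suc s)              ≡⟨ W-prime-power-p∣ pp s (p ^ t * w) ⟩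
    p * W (p ^ t * w) (p ^ s) + p ^ s * (p ∸ 1)  ≡⟨ induction s ⟩
    (suc t ⊓ suc s + 1) * (p ^ s * (p ∸ 1)) + θ (suc t) (suc s) * p ^ s ∎
    where
    open ≡-Reasoning
    base : ∀ k → suc k * 1 + 1 * k ≡ 2 * (1 * k) + 1 * 1
    base = solve-∀
    step : ∀ p k a θ X → p * (a * (X * k) + θ * X) + p * X * k ≡ suc a * (p * X * k) + θ * (p * X)
    step = solve-∀
    induction : ∀ s → p * W (p ^ t * w) (p ^ s) + p ^ s * (p ∸ 1) ≡
                      (suc t ⊓ suc s + 1) * (p ^ s * (p ∸ 1)) + θ (suc t) (suc s) * p ^ s
    induction zero = begin
      p * W (p ^ t * w) 1 + 1 * (p ∸ 1)       ≡⟨ cong (λ v → p * v + 1 * (p ∸ 1)) (W-one (p ^ t * w)) ⟩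
      p * 1 + 1 * (p ∸ 1)                     ≡⟨ cong (λ x → x * 1 + 1 * (p ∸ 1)) (suc-pred p {{prime⇒nonZero pp}}) ⟨
      suc (p ∸ 1) * 1 + 1 * (p ∸ 1)           ≡⟨ base (p ∸ 1) ⟩
      2 * (1 * (p ∸ 1)) + 1 * 1               ≡⟨ cong (λ x → (suc x + 1) * (1 * (p ∸ 1)) + 1 * 1) (⊓-zeroʳ t) ⟨
      (suc (t ⊓ 0) + 1) * (1 * (p ∸ 1)) + 1 * 1 ∎
    induction (suc s) =
      trans (cong (λ v → p * v + p ^ suc s * (p ∸ 1)) (W-prime-power pp s t w p∤w))
            (step p (p ∸ 1) (t ⊓ suc s + 1) (θ t (suc s)) (p ^ s))

  localFactor : ℕ → ℕ → ℕ → ℕ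
  localFactor p s t = (t ⊓ s + 1) * φ (p ^ s) + θ t s * p ^ (s ∸ 1)

  W-local : ∀ {p} → Prime p → ∀ s t w → 1 ≤ s → ¬ p ∣ w → W (p ^ t * w) (p ^ s) ≡ localFactor p s t
  W-local {p} pp (suc s) t w _ p∤w =
    trans (W-prime-power pp s t w p∤w)
          (cong (λ v → (t ⊓ suc s + 1) * v + θ t (suc s) * p ^ s) (sym (φ-prime-power pp s)))

  prime∤∏ : ∀ {q} → Prime q → ∀ r (f : Fin r → ℕ) → (∀ i → ¬ q ∣ f i) → ¬ q ∣ ∏ f
  prime∤∏ pq zero    f q∤f q∣1 = prime≢1 pq (∣1⇒≡1 q∣1)
  prime∤∏ pq (suc r) f q∤f q∣∏ with euclidsLemma (f zero) (∏ (λ i → f (suc i))) pq q∣∏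
  ... | inj₁ q∣f₀ = q∤f zero q∣f₀
  ... | inj₂ q∣∏′ = prime∤∏ pq r (λ i → f (suc i)) (λ i → q∤f (suc i)) q∣∏′

  -- Induction on the number of primes: split off p₀^s₀, which is coprime to the rest
  -- of n, and absorb p₀^t₀ into the unit part u of m for the remaining primes.
  W-∏ : ∀ r (p s t : Fin r → ℕ) u → (∀ j → Prime (p j)) → Injective _≡_ _≡_ p → (∀ j → 1 ≤ s j) →
        (∀ i → Coprime u (p i)) →
        W (u * ∏ (λ i → p i ^ t i)) (∏ (λ j → p j ^ s j)) ≡ ∏ (λ i → localFactor (p i) (s i) (t i))
  W-∏ zero    p s t u prime inj s≥1 u⊥p = W-one (u * 1)
  W-∏ (suc r) p s t u prime inj s≥1 u⊥p = begin
    W m (p₀ ^ s zero * n′)          ≡⟨ W-multiplicative m (p₀ ^ s zero) n′ {{m^n≢0 p₀ (s zero) {{p₀≢0}}}} p₀^s₀⊥n′ ⟩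
    W m (p₀ ^ s zero) * W m n′      ≡⟨ cong₂ _*_ local-p₀ local-rest ⟩
    ∏ (λ i → localFactor (p i) (s i) (t i)) ∎
    where
    open ≡-Reasoning
    p₀ = p zero
    n′ = ∏ (λ j → p (suc j) ^ s (suc j))
    m′ = ∏ (λ j → p (suc j) ^ t (suc j))
    m = u * (p₀ ^ t zero * m′)
    p₀≢0 : NonZero p₀
    p₀≢0 = prime⇒nonZero (prime zero)
    p₀∤pᵢ : ∀ i → ¬ p₀ ∣ p (suc i)
    p₀∤pᵢ i = distinct-primes-∤ (prime zero) (prime (suc i)) (Fin.0≢1+n ∘′ inj)
    p₀∤∏ : ∀ (e : Fin r → ℕ) → ¬ p₀ ∣ ∏ (λ j → p (suc j) ^ e j)
    p₀∤∏ e = prime∤∏ (prime zero) r _ (λ i → prime∤^ (prime zero) (p₀∤pᵢ i) (e i))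
    p₀^s₀⊥n′ : Coprime (p₀ ^ s zero) n′
    p₀^s₀⊥n′ = Coprime.sym (coprime-^ʳ (s zero) (prime∤⇒coprime (prime zero) (p₀∤∏ (λ j → s (suc j)))))
    p₀∤um′ : ¬ p₀ ∣ u * m′
    p₀∤um′ p₀∣um′ with euclidsLemma u m′ (prime zero) p₀∣um′
    ... | inj₁ p₀∣u  = prime≢1 (prime zero) (u⊥p zero (p₀∣u , ∣-refl))
    ... | inj₂ p₀∣m′ = p₀∤∏ (λ j → t (suc j)) p₀∣m′
    m≡p₀-part : m ≡ p₀ ^ t zero * (u * m′)
    m≡p₀-part = trans (sym (*-assoc u (p₀ ^ t zero) m′)) (trans (cong (_* m′) (*-comm u (p₀ ^ t zero))) (*-assoc (p₀ ^ t zero) u m′))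
    local-p₀ : W m (p₀ ^ s zero) ≡ localFactor p₀ (s zero) (t zero)
    local-p₀ = trans (cong (λ k → W k (p₀ ^ s zero)) m≡p₀-part)
                     (W-local (prime zero) (s zero) (t zero) (u * m′) (s≥1 zero) p₀∤um′)
    u′⊥pᵢ : ∀ i → Coprime (u * p₀ ^ t zero) (p (suc i))
    u′⊥pᵢ i = Coprime.sym (coprime-*ʳ (Coprime.sym (u⊥p (suc i)))
                                      (coprime-^ʳ (t zero) (prime∤⇒coprime (prime zero) (p₀∤pᵢ i))))
    local-rest : W m n′ ≡ ∏ (λ i → localFactor (p (suc i)) (s (suc i)) (t (suc i)))
    local-rest = trans (cong (λ k → W k n′) (sym (*-assoc u (p₀ ^ t zero) m′)))
                       (W-∏ r (λ i → p (suc i)) (λ i → s (suc i)) (λ i → t (suc i)) (u * p₀ ^ t zero)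
                            (λ i → prime (suc i)) (Fin.suc-injective ∘′ inj) (λ i → s≥1 (suc i)) u′⊥pᵢ)

module CharacterSum {c ℓ : Level} (R : CommutativeRing c ℓ) where
  open import Data.Nat.Base using (NonZero)
  open import Data.Nat.DivMod using (_%_; _/_; m≡m%n+[m/n]*n; m%n<n)
  open import Data.Nat.Divisibility using (_∣_; _∣?_; divides; n∣m*n; m%n≡0⇒n∣m; *-cancelˡ-∣)
  open import Data.Nat.GCD using (gcd; gcd[m,n]∣n; gcd-identityˡ)
  open import Data.Nat.Coprimality using (coprime-divisor)
  open import Data.Nat.Tactic.RingSolver using (solve-∀)
  open import Data.Product.Base using (proj₁; proj₂)
  open import Data.Sum.Base using (inj₁; inj₂)
  open import Data.Empty using (⊥-elim)
  open import Function.Base using (_∘′_)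
  open import Relation.Nullary using (¬_; Dec; yes; no)
  open CommutativeRing R
  open import Relation.Binary.Reasoning.Setoid setoid
  open import Algebra.Properties.Group +-group using (∙-cancelˡ; x∙y⁻¹≈ε⇒x≈y)
  open import Algebra.Properties.Ring ring using (-1*x≈-x)
  open FiniteSums commutativeSemiring
  private
    module A = Arithmetic
  open WeightedGcdSum using (weight; W)

  fromℕ-+ : ∀ a b → fromℕ R (a ℕ.+ b) ≈ fromℕ R a + fromℕ R b
  fromℕ-+ zero    b = sym (+-identityˡ _)
  fromℕ-+ (suc a) b = trans (+-congˡ (fromℕ-+ a b)) (sym (+-assoc _ _ _))

  fromℕ-Σ : ∀ n (f : ℕ → ℕ) → fromℕ R (A.Σ n f) ≈ Σ n (λ k → fromℕ R (f k))
  fromℕ-Σ zero    f = refl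
  fromℕ-Σ (suc n) f = trans (fromℕ-+ (f 0) _) (+-congˡ (fromℕ-Σ n (λ k → f (suc k))))

  Σ-ones : ∀ g → Σ g (λ _ → 1#) ≈ fromℕ R g
  Σ-ones zero    = refl
  Σ-ones (suc g) = +-congˡ (Σ-ones g)

  sum1-Σ : ∀ n (f : ℕ → Carrier) → sum1 R n f ≈ Σ n (λ k → f (suc k))
  sum1-Σ zero    f = refl
  sum1-Σ (suc n) f = trans (+-congʳ (sum1-Σ n f)) (sym (Σ-snoc n (λ k → f (suc k))))

  pow-cong : ∀ {x y} k → x ≈ y → pow R x k ≈ pow R y k
  pow-cong zero    e = refl
  pow-cong (suc k) e = *-cong e (pow-cong k e)

  pow-+ : ∀ x a b → pow R x (a ℕ.+ b) ≈ pow R x a * pow R x b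
  pow-+ x zero    b = sym (*-identityˡ _)
  pow-+ x (suc a) b = trans (*-congˡ (pow-+ x a b)) (sym (*-assoc _ _ _))

  pow-* : ∀ x a b → pow R x (a ℕ.* b) ≈ pow R (pow R x a) b
  pow-* x a zero    = reflexive (≡.cong (pow R x) (ℕ.*-zeroʳ a))
  pow-* x a (suc b) = begin
    pow R x (a ℕ.* suc b)                 ≡⟨ ≡.cong (pow R x) (ℕ.*-suc a b) ⟩
    pow R x (a ℕ.+ a ℕ.* b)               ≈⟨ pow-+ x a (a ℕ.* b) ⟩
    pow R x a * pow R x (a ℕ.* b)         ≈⟨ *-congˡ (pow-* x a b) ⟩
    pow R x a * pow R (pow R x a) b       ∎

  pow-1# : ∀ k → pow R 1# k ≈ 1#
  pow-1# zero    = refl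
  pow-1# (suc k) = trans (*-identityˡ _) (pow-1# k)

  geometric-trivial : ∀ g η → η ≈ 1# → Σ g (pow R η) ≈ fromℕ R g
  geometric-trivial g η η≈1 = trans (Σ-congᵉ g (λ q → trans (pow-cong q η≈1) (pow-1# q))) (Σ-ones g)

  -- In an integral domain, (η − 1)·S = η^g − 1 = 0 with η ≠ 1 forces S = 0.
  geometric-vanishes : NoZeroDivisors R → ∀ g η → pow R η g ≈ 1# → ¬ (η ≈ 1#) → Σ g (pow R η) ≈ 0#
  geometric-vanishes noZeroDiv g η ηᵍ≈1 η≉1 with noZeroDiv (η - 1#) S [η-1]S≈0
    where
    S = Σ g (pow R η)
    ηS≈S : η * S ≈ S
    ηS≈S = ∙-cancelˡ 1# _ _ (begin
      1# + η * S          ≈⟨ +-congˡ (Σ-*ˡ g η (pow R η)) ⟩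
      Σ (suc g) (pow R η) ≈⟨ Σ-snoc g (pow R η) ⟩
      S + pow R η g       ≈⟨ +-congˡ ηᵍ≈1 ⟩
      S + 1#              ≈⟨ +-comm _ _ ⟩
      1# + S              ∎)
    [η-1]S≈0 : (η - 1#) * S ≈ 0#
    [η-1]S≈0 = begin
      (η + - 1#) * S      ≈⟨ distribʳ _ _ _ ⟩
      η * S + - 1# * S    ≈⟨ +-cong ηS≈S (-1*x≈-x S) ⟩
      S + - S             ≈⟨ -‿inverseʳ S ⟩
      0#                  ∎
  ... | inj₁ η-1≈0 = ⊥-elim (η≉1 (x∙y⁻¹≈ε⇒x≈y η 1# η-1≈0))
  ... | inj₂ S≈0   = S≈0

  Σ-multiples : ∀ g d .{{_ : NonZero d}} (h : ℕ → Carrier) →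
                Σ (g ℕ.* d) (λ y → fromℕ R (A.𝟙 (d ∣? y)) * h y) ≈ Σ g (λ q → h (q ℕ.* d))
  Σ-multiples g d@(suc d′) h = begin
    Σ (g ℕ.* d) F                                                       ≈⟨ Σ-block g d F ⟩
    Σ g (λ q → F (q ℕ.* d ℕ.+ 0) + Σ d′ (λ r → F (q ℕ.* d ℕ.+ suc r)))  ≈⟨ Σ-congᵉ g (λ q →
                                                                            +-cong (multiple q) (Σ-zero d′ _ (non-multiple q))) ⟩
    Σ g (λ q → h (q ℕ.* d) + 0#)                                        ≈⟨ Σ-congᵉ g (λ q → +-identityʳ _) ⟩
    Σ g (λ q → h (q ℕ.* d))                                             ∎
    where
    F : ℕ → Carrier
    F y = fromℕ R (A.𝟙 (d ∣? y)) * h y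
    multiple : ∀ q → F (q ℕ.* d ℕ.+ 0) ≈ h (q ℕ.* d)
    multiple q = begin
      F (q ℕ.* d ℕ.+ 0)            ≡⟨ ≡.cong F (ℕ.+-identityʳ _) ⟩
      F (q ℕ.* d)                  ≡⟨ ≡.cong (λ b → fromℕ R b * h (q ℕ.* d)) (A.𝟙-yes (d ∣? q ℕ.* d) (n∣m*n q)) ⟩
      (1# + 0#) * h (q ℕ.* d)      ≈⟨ *-congʳ (+-identityʳ 1#) ⟩
      1# * h (q ℕ.* d)             ≈⟨ *-identityˡ _ ⟩
      h (q ℕ.* d)                  ∎
    non-multiple : ∀ q r → r < d′ → F (q ℕ.* d ℕ.+ suc r) ≈ 0#
    non-multiple q r r<d′ = begin
      F (q ℕ.* d ℕ.+ suc r)        ≡⟨ ≡.cong (λ b → fromℕ R b * h (q ℕ.* d ℕ.+ suc r))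
                                        (A.𝟙-no (d ∣? _) (A.∤-nonzero-residue d q r (s≤s r<d′))) ⟩
      0# * h (q ℕ.* d ℕ.+ suc r)   ≈⟨ zeroˡ _ ⟩
      0#                           ∎

  module _ (noZeroDiv : NoZeroDivisors R) (n : ℕ) .{{_ : NonZero n}} (ζ : Carrier)
           (ζ-primitive : PrimitiveRoot R n ζ) (m : ℕ) where

    root-power : ∀ x → pow R ζ (n ℕ.* x) ≈ 1#
    root-power x = trans (pow-* ζ n x) (trans (pow-cong x (proj₁ ζ-primitive)) (pow-1# x))

    root-order : ∀ a → pow R ζ a ≈ 1# → n ∣ a
    root-order a ζᵃ≈1 with a % n in a%n≡r
    ... | zero  = m%n≡0⇒n∣m a n a%n≡r
    ... | suc r = ⊥-elim (proj₂ ζ-primitive (suc r) (s≤s z≤n) (≡.subst (_< n) a%n≡r (m%n<n a n)) ζʳ⁺¹≈1)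
      where
      ζʳ⁺¹≈1 : pow R ζ (suc r) ≈ 1#
      ζʳ⁺¹≈1 = begin
        pow R ζ (suc r)                               ≈⟨ *-identityʳ _ ⟨
        pow R ζ (suc r) * 1#                          ≈⟨ *-congˡ (root-power (a / n)) ⟨
        pow R ζ (suc r) * pow R ζ (n ℕ.* (a / n))     ≈⟨ pow-+ ζ (suc r) _ ⟨
        pow R ζ (suc r ℕ.+ n ℕ.* (a / n))             ≡⟨ ≡.cong (pow R ζ) (≡.sym (≡.trans (m≡m%n+[m/n]*n a n)
                                                            (≡.cong₂ ℕ._+_ a%n≡r (ℕ.*-comm (a / n) n)))) ⟩
        pow R ζ a                                     ≈⟨ ζᵃ≈1 ⟩
        1#                                            ∎

    -- The k-th root of unity in the theorem, ζ^{-k·m} = ζ^{(n-1)·k·m}.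
    z : ℕ → Carrier
    z k = pow R ζ ((n ℕ.∸ 1) ℕ.* k ℕ.* m)

    ι : ℕ → ℕ → Carrier
    ι j k = fromℕ R (A.𝟙 (n ∣? j ℕ.* k))

    Σ-kernel : ∀ x d → n ≡.≡ d ℕ.* gcd x n → (h : ℕ → Carrier) →
               Σ n (λ y → ι x y * h y) ≈ Σ (gcd x n) (λ q → h (q ℕ.* d))
    Σ-kernel x d n≡dg h = begin
      Σ n (λ y → ι x y * h y)                              ≡⟨ ≡.cong (λ N → Σ N (λ y → ι x y * h y)) (≡.trans n≡dg (ℕ.*-comm d g)) ⟩
      Σ (g ℕ.* d) (λ y → ι x y * h y)                      ≈⟨ Σ-congᵉ (g ℕ.* d) (λ y → *-congʳ (reflexive (≡.cong (fromℕ R)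
                                                                (A.𝟙-cong (A.∣*⇒cofactor∣ x n d y n≡dg) (A.cofactor∣⇒∣* x n d y n≡dg) (n ∣? x ℕ.* y) (d ∣? y))))) ⟩
      Σ (g ℕ.* d) (λ y → fromℕ R (A.𝟙 (d ∣? y)) * h y)     ≈⟨ Σ-multiples g d h ⟩
      Σ g (λ q → h (q ℕ.* d))                              ∎
      where
      g = gcd x n
      instance
        d≢0 : NonZero d
        d≢0 = A.cofactor-nonZero n≡dg

    gcd-as-count : ∀ k → fromℕ R (gcd k n) ≈ Σ n (λ j → ι j k)
    gcd-as-count k with divides d n≡dg ← gcd[m,n]∣n k n = sym (begin
      Σ n (λ j → ι j k)                        ≈⟨ Σ-congᵉ n (λ j → trans (reflexive (≡.cong (λ a → fromℕ R (A.𝟙 (n ∣? a))) (ℕ.*-comm j k)))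
                                                                         (sym (*-identityʳ _))) ⟩
      Σ n (λ j → ι k j * 1#)                   ≈⟨ Σ-kernel k d n≡dg (λ _ → 1#) ⟩
      Σ (gcd k n) (λ _ → 1#)                   ≈⟨ Σ-ones (gcd k n) ⟩
      fromℕ R (gcd k n)                        ∎)

    -- Σ_{k<n} [n ∣ j·k]·ζ^{-k·m} = [g ∣ m]·g  for g = gcd(j, n): a geometric sum in
    -- η = ζ^{-d·m} (n = d·g), a g-th root of unity which is 1 exactly when g ∣ m.
    Σ-kernel-character : ∀ j → Σ n (λ k → ι j k * z k) ≈ fromℕ R (weight m (gcd j n))
    Σ-kernel-character j with divides d n≡dg ← gcd[m,n]∣n j n = begin
      Σ n (λ k → ι j k * z k)                  ≈⟨ Σ-kernel j d n≡dg z ⟩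
      Σ g (λ q → z (q ℕ.* d))                  ≈⟨ Σ-congᵉ g z-multiple ⟩
      Σ g (pow R η)                            ≈⟨ geometric (g ∣? m) ⟩
      fromℕ R (g ℕ.* A.𝟙 (g ∣? m))             ∎
      where
      g = gcd j n
      e = (n ℕ.∸ 1) ℕ.* d ℕ.* m
      η = pow R ζ e
      instance
        d≢0 : NonZero d
        d≢0 = A.cofactor-nonZero n≡dg
      regroup₁ : ∀ a q d m → a ℕ.* (q ℕ.* d) ℕ.* m ≡.≡ a ℕ.* d ℕ.* m ℕ.* q
      regroup₁ = solve-∀
      regroup₂ : ∀ a d m g → a ℕ.* d ℕ.* m ℕ.* g ≡.≡ d ℕ.* g ℕ.* (a ℕ.* m)
      regroup₂ = solve-∀
      regroup₃ : ∀ a d m′ g → a ℕ.* d ℕ.* (m′ ℕ.* g) ≡.≡ d ℕ.* g ℕ.* (a ℕ.* m′)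
      regroup₃ = solve-∀
      regroup₄ : ∀ a d m → a ℕ.* d ℕ.* m ≡.≡ d ℕ.* (a ℕ.* m)
      regroup₄ = solve-∀
      z-multiple : ∀ q → z (q ℕ.* d) ≈ pow R η q
      z-multiple q = trans (reflexive (≡.cong (pow R ζ) (regroup₁ (n ℕ.∸ 1) q d m))) (pow-* ζ e q)
      ηᵍ≈1 : pow R η g ≈ 1#
      ηᵍ≈1 = trans (sym (pow-* ζ e g)) (trans (reflexive (≡.cong (pow R ζ)
               (≡.trans (regroup₂ (n ℕ.∸ 1) d m g) (≡.cong (ℕ._* ((n ℕ.∸ 1) ℕ.* m)) (≡.sym n≡dg))))) (root-power _))
      g∣m⇒η≈1 : g ∣ m → η ≈ 1#
      g∣m⇒η≈1 (divides m′ m≡m′g) = trans (reflexive (≡.cong (pow R ζ)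
        (≡.trans (≡.cong ((n ℕ.∸ 1) ℕ.* d ℕ.*_) m≡m′g)
          (≡.trans (regroup₃ (n ℕ.∸ 1) d m′ g) (≡.cong (ℕ._* ((n ℕ.∸ 1) ℕ.* m′)) (≡.sym n≡dg)))))) (root-power _)
      η≈1⇒g∣m : η ≈ 1# → g ∣ m
      η≈1⇒g∣m η≈1 = coprime-divisor (A.divisor-coprime-pred (gcd[m,n]∣n j n))
        (*-cancelˡ-∣ d (≡.subst₂ _∣_ n≡dg (regroup₄ (n ℕ.∸ 1) d m) (root-order e η≈1)))
      geometric : (g∣?m : Dec (g ∣ m)) → Σ g (pow R η) ≈ fromℕ R (g ℕ.* A.𝟙 g∣?m)
      geometric (yes g∣m) = trans (geometric-trivial g η (g∣m⇒η≈1 g∣m)) (reflexive (≡.cong (fromℕ R) (≡.sym (ℕ.*-identityʳ g))))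
      geometric (no g∤m)  = trans (geometric-vanishes noZeroDiv g η ηᵍ≈1 (g∤m ∘′ η≈1⇒g∣m))
                                  (reflexive (≡.cong (fromℕ R) (≡.sym (ℕ.*-zeroʳ g))))

    -- Σ_{k=1}^{n} gcd(k, n)·ζ^{-k·m} = W(m, n): expand gcd(k, n) as a count, swap the sums.
    character-sum : sum1 R n (λ k → fromℕ R (gcd k n) * z k) ≈ fromℕ R (W m n)
    character-sum = begin
      sum1 R n f                                    ≈⟨ sum1-Σ n f ⟩
      Σ n (λ k → f (suc k))                         ≈⟨ Σ-rotate n f f₀≈fₙ ⟩
      Σ n f                                         ≈⟨ Σ-congᵉ n (λ k → *-congʳ (gcd-as-count k)) ⟩
      Σ n (λ k → Σ n (λ j → ι j k) * z k)           ≈⟨ Σ-congᵉ n (λ k → Σ-*ʳ n (z k) (λ j → ι j k)) ⟩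
      Σ n (λ k → Σ n (λ j → ι j k * z k))           ≈⟨ Σ-swap n n (λ k j → ι j k * z k) ⟩
      Σ n (λ j → Σ n (λ k → ι j k * z k))           ≈⟨ Σ-congᵉ n Σ-kernel-character ⟩
      Σ n (λ j → fromℕ R (weight m (gcd j n)))      ≈⟨ fromℕ-Σ n (λ j → weight m (gcd j n)) ⟨
      fromℕ R (W m n)                               ∎
      where
      f : ℕ → Carrier
      f k = fromℕ R (gcd k n) * z k
      regroup : ∀ a n m → a ℕ.* n ℕ.* m ≡.≡ n ℕ.* (a ℕ.* m)
      regroup = solve-∀
      f₀≈fₙ : f 0 ≈ f n
      f₀≈fₙ = *-cong (reflexive (≡.cong (fromℕ R) (≡.trans (gcd-identityˡ n) (≡.sym (A.gcd-idem n)))))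
                     (trans (reflexive (≡.cong (λ e → pow R ζ (e ℕ.* m)) (ℕ.*-zeroʳ (n ℕ.∸ 1))))
                            (sym (trans (reflexive (≡.cong (pow R ζ) (regroup (n ℕ.∸ 1) n m))) (root-power _))))

open import Data.Nat.Base using (_+_; _*_; _∸_; _^_; _≤_; _⊓_)
open import Data.Nat.GCD using (gcd)
open import Data.Nat.Primality using (Prime)
open import Data.Nat.Coprimality using (Coprime)
open import Data.Fin using (Fin)
open import Function.Definitions using (Injective)
open import Relation.Binary.PropositionalEquality using (_≡_)

-- The character sum equals W(m, n), which is the product of the local factors.
theorem1 : {c ℓ : Level} (R : CommutativeRing c ℓ) → NoZeroDivisors R →
           (n : ℕ) (ζ : CommutativeRing.Carrier R) → PrimitiveRoot R n ζ →
           (r : ℕ) (p s t : Fin r → ℕ) (u m : ℕ) →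
           (∀ j → Prime (p j)) → Injective _≡_ _≡_ p → (∀ j → 1 ≤ s j) →
           1 ≤ n → n ≡ ∏ (λ j → p j ^ s j) →
           1 ≤ m → m ≤ n → m ≡ u * ∏ (λ i → p i ^ t i) → (∀ i → Coprime u (p i)) →
           CommutativeRing._≈_ R
             (sum1 R n (λ k → CommutativeRing._*_ R (fromℕ R (gcd k n)) (pow R ζ ((n ∸ 1) * k * m))))
             (fromℕ R (∏ (λ i → (t i ⊓ s i + 1) * φ (p i ^ s i) + θ (t i) (s i) * p i ^ (s i ∸ 1))))
theorem1 R noZeroDiv n ζ ζ-primitive r p s t u m prime inj s≥1 n≥1 n≡∏ _ _ m≡u∏ u⊥p = begin
  sum1 R n (λ k → fromℕ R (gcd k n) · pow R ζ ((n ∸ 1) * k * m))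
    ≈⟨ character-sum noZeroDiv n {{ℕ.>-nonZero n≥1}} ζ ζ-primitive m ⟩
  fromℕ R (W m n)
    ≡⟨ ≡.cong (fromℕ R) (≡.cong₂ W m≡u∏ n≡∏) ⟩
  fromℕ R (W (u * ∏ (λ i → p i ^ t i)) (∏ (λ j → p j ^ s j)))
    ≡⟨ ≡.cong (fromℕ R) (W-∏ r p s t u prime inj s≥1 u⊥p) ⟩
  fromℕ R (∏ (λ i → localFactor (p i) (s i) (t i)))  ∎
  where
  open CommutativeRing R using (setoid) renaming (_*_ to _·_)
  open import Relation.Binary.Reasoning.Setoid setoid
  open CharacterSum R using (character-sum)
  open WeightedGcdSum using (W; W-∏; localFactor)
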